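{- Let $G=(V,E)$ be an $s$-$t$ graph and suppose that the $s$- and $t$-dominator trees of $G$ are collapsed. Let $u$ be a vertex in the collapsed trees. Then $\mathrm{ext}(u)$ is a maximal safe sequence (for walk covers of $G$) if and only if $u$ is a leaf in both collapsed dominator trees.
   Context: An $s$-$t$ graph is a directed graph without parallel edges (self-loops allowed) with a unique source $s$ and a unique sink $t$. A walk may repeat vertices and edges; a walk cover is a set $P$ of $s$-$t$ walks such that every vertex of $G$ lies on some walk of $P$. A sequence $X=u_1,\dots,u_\ell$ of vertices requires a $u_i$-$u_{i+1}$ path for each $i$; $X$ is a subsequence of $X'$ if obtained from $X'$ by deleting entries. $X$ is safe if every walk cover contains a walk having $X$ as a subsequence; it is a maximal safe sequence if it is safe and not a proper subsequence of another safe sequence. $u$ $s$-dominates $v$ if every $s$-$v$ path contains $u$; $t$-domination is analogous with $v$-$t$ paths. The $s$-dominator tree (rooted at $s$) gives each $v\neq s$ its immediate $s$-dominator as parent; the $t$-dominator tree is analogous (rooted at $t$). $\mathrm{ext}(v)$ is the sequence formed by the path from $s$ to $v$ in the $s$-dominator tree followed by the path from $v$ to $t$ in the $t$-dominator tree ($v$ written once). A univocal path is a sequence $v_1\dots v_k$ ($k\ge1$) such that in the $t$-dominator tree $v_{i+1}$ is the parent of $v_i$ and $v_i$ is its unique child ($1\le i<k$), and in the $s$-dominator tree $v_i$ is the parent of $v_{i+1}$ and each of $v_1,\dots,v_{k-1}$ has exactly one child; it is maximal if not a proper subpath of another univocal path (distinct maximal univocal paths are vertex-disjoint). The trees are collapsed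 by replacing, in both trees, each maximal univocal path $v_1\dots v_k$ by a single vertex (represented by $v_1$, the deepest one in the $t$-dominator tree) which stores the ordered sequence $v_1,\dots,v_k$; whenever an extension $\mathrm{ext}(\cdot)$ computed in the collapsed trees passes through a collapsed vertex, the stored sequence is substituted for it. -}

module Defs where

open import Level using (Level; suc; _⊔_)
open import Data.Nat using (ℕ)
open import Data.Fin using (Fin)
open import Data.Bool using (Bool; true; false)
open import Data.List using (List; []; _∷_; _++_; concat; drop)
open import Data.List.Membership.Propositional using (_∈_)
open import Data.List.Relation.Unary.Unique.Propositional using (Unique)
open import Data.List.Relation.Binary.Infix.Heterogeneous using (Infix)
import Data.List.Relation.Binary.Sublist.Propositional as Sub
open import Data.Product using (Σ; ∃; ∃-syntax; _×_; _,_)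
open import Data.Unit using (⊤)
open import Data.Empty using (⊥)
open import Relation.Nullary using (¬_)
open import Relation.Binary.PropositionalEquality using (_≡_; _≢_)

data Chain {ℓ r : Level} {A : Set ℓ} (R : A → A → Set r) : A → A → List A → Set (ℓ ⊔ r) where
  here  : ∀ a → Chain R a a (a ∷ [])
  there : ∀ {a b c xs} → R a b → Chain R b c xs → Chain R a c (a ∷ xs)

-- An s-t graph on the vertex set Fin n. The edge set is a Boolean adjacency
-- relation (so no parallel edges; self-loops allowed).
record STGraph : Set where
  field
    n : ℕ
    E : Fin n → Fin n → Bool
    s t : Fin n

  Edge : Fin n → Fin n → Set
  Edge u v = E u v ≡ true

  Walk : Fin n → Fin n → List (Fin n) → Set
  Walk = Chain Edge

  Path : Fin n → Fin n → List (Fin n) → Set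
  Path u v xs = Walk u v xs × Unique xs

  IsSource : Fin n → Set
  IsSource v = ∀ u → E u v ≡ false

  IsSink : Fin n → Set
  IsSink v = ∀ w → E v w ≡ false

  field
    s-source : IsSource s
    s-unique : ∀ v → IsSource v → v ≡ s
    t-sink   : IsSink t
    t-unique : ∀ v → IsSink v → v ≡ t
    reach-s  : ∀ v → ∃[ xs ] Path s v xs
    reach-t  : ∀ v → ∃[ xs ] Path v t xs

module _ (G : STGraph) where
  open STGraph G

  V : Set
  V = Fin n

  IsSequence : List V → Set
  IsSequence []           = ⊤
  IsSequence (x ∷ [])     = ⊤
  IsSequence (x ∷ y ∷ xs) = (∃[ p ] Path x y p) × IsSequence (y ∷ xs)

  _⊑_ : List V → List V → Set
  _⊑_ = Sub._⊆_

  IsWalkCover : (List V → Set) → Set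
  IsWalkCover P = (∀ w → P w → Walk s t w) × (∀ v → ∃[ w ] (P w × v ∈ w))

  Safe : List V → Set₁
  Safe X = IsSequence X × (∀ P → IsWalkCover P → ∃[ w ] (P w × X ⊑ w))

  MaxSafe : List V → Set₁
  MaxSafe X = Safe X × (∀ Y → Safe Y → X ⊑ Y → X ≡ Y)

  SDom : V → V → Set
  SDom u v = ∀ xs → Path s v xs → u ∈ xs

  TDom : V → V → Set
  TDom u v = ∀ xs → Path v t xs → u ∈ xs

  -- p is the parent of v in the s-dominator tree (p = immediate s-dominator of v):
  -- p strictly s-dominates v and every strict s-dominator of v s-dominates p.
  SParent : V → V → Set
  SParent p v = v ≢ s × p ≢ v × SDom p v × (∀ d → d ≢ v → SDom d v → SDom d p)

  TParent : V → V → Set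
  TParent p v = v ≢ t × p ≢ v × TDom p v × (∀ d → d ≢ v → TDom d v → TDom d p)

  Univocal : List V → Set
  Univocal []           = ⊥
  Univocal (v ∷ [])     = ⊤
  Univocal (v ∷ w ∷ xs) =
    TParent w v × (∀ c → TParent w c → c ≡ v) ×
    SParent v w × (∀ c → SParent v c → c ≡ w) ×
    Univocal (w ∷ xs)

  MaxUnivocal : List V → Set
  MaxUnivocal xs = Univocal xs × (∀ ys → Univocal ys → Infix _≡_ xs ys → xs ≡ ys)

  -- Collapsed trees: vertices are the maximal univocal paths (the stored
  -- sequences v1 ... vk); C' is the parent of C in the collapsed tree iff
  -- some tree edge joins a member of C' (parent) to a member of C (child).
  CSParent : List V → List V → Set
  CSParent C' C = MaxUnivocal C' × MaxUnivocal C × C' ≢ C ×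
                  ∃[ x ] ∃[ y ] (x ∈ C' × y ∈ C × SParent x y)

  CTParent : List V → List V → Set
  CTParent C' C = MaxUnivocal C' × MaxUnivocal C × C' ≢ C ×
                  ∃[ x ] ∃[ y ] (x ∈ C' × y ∈ C × TParent x y)

  SLeaf : List V → Set
  SLeaf C = ∀ D → ¬ CSParent C D

  TLeaf : List V → Set
  TLeaf C = ∀ D → ¬ CTParent C D

  -- ext(C) computed in the collapsed trees, with each collapsed vertex replaced
  -- by its stored sequence: Cs is the collapsed s-tree path from the root
  -- (the class containing s) down to C, Ds the collapsed t-tree path from C up
  -- to the root (the class containing t); C is written once.
  IsExt : List V → List V → Set
  IsExt C X =
    ∃[ C₀ ] ∃[ Cs ] ∃[ D ] ∃[ Ds ]
      ( MaxUnivocal C₀ × s ∈ C₀ × Chain CSParent C₀ C Cs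
      × MaxUnivocal D × t ∈ D × Chain (λ a b → CTParent b a) C D Ds
      × X ≡ concat Cs ++ concat (drop 1 Ds))

-- Dominance is decidable, because an avoiding path, if there is one, is found among the lists of at
-- most n vertices; it is a partial order on a finite set, hence well-founded, and iterating immediate
-- dominators gives the tree path from s to every vertex. Post-dominance is dominance in the reversed
-- graph. A maximal univocal path u is a chain of univocal links that cannot be extended at either end,
-- so a collapsed tree edge leaves u only at its last vertex b (s-tree) or at its first vertex a
-- (t-tree), and ext(u) unfolds to the s-tree path from s to b through u followed by the t-tree path
-- from a to t through u.
--
-- A chain of strict s-dominators down to z followed by strict t-dominators up from z is safe: every
-- walk through z meets them in order. In particular ext(u) is safe. A tree edge can be realised by a
-- walk whose interior avoids any one prescribed vertex. So if u is a leaf in both collapsed trees and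
-- Y properly contains ext(u), the s-t walks not containing Y cover the graph: through vertices of u
-- follow ext(u), at each edge dodging the next unmatched entry of Y; through any other vertex z follow
-- the tree paths s … z … t, which miss a since u has no collapsed children. Conversely, let u have a
-- collapsed s-child, reached from b by a tree edge b → y, and let e be the t-parent of b. An s-child of
-- b is t-dominated by e and a t-child of e is s-dominated by b, so an s-child of b other than e, or a
-- t-child of e other than b, could be inserted into ext(u) between b and e; by maximality there is
-- none. Hence y = e and b → e is a univocal link, contradicting the maximality of u. Collapsed
-- t-children are symmetric.

module Submission where

open import Defs
open import Level using (Level; _⊔_)
open import Function using (_∘_; id; flip; case_of_)
open import Function.Bundles using (_⇔_; mk⇔)
open import Data.Empty using (⊥; ⊥-elim)
open import Data.Unit using (tt)
open import Data.Sum using (_⊎_; inj₁; inj₂)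
open import Data.Product using (∃₂; ∃-syntax; _×_; _,_; proj₁; proj₂)
open import Data.Nat using (zero; suc; _≤_; z≤n; s≤s)
open import Data.Bool using (true)
import Data.Bool.Properties as Bool
open import Data.Fin using (Fin; _≟_)
import Data.Fin.Properties as Fin
open import Data.Fin.Induction using (po-wellFounded; po-noetherian)
open import Data.List using (List; []; _∷_; _++_; length; reverse; concat; initLast; _∷ʳ′_)
open import Data.List.Properties
  using (++-assoc; ++-identityʳ; ++-identityʳ-unique; ++-identityˡ-unique; ++-cancelˡ; ∷-injectiveˡ; ∷-injectiveʳ;
         unfold-reverse; reverse-injective; reverse-++; concat-++; length-tabulate; length-removeAt′; ≡-dec)
open import Data.List.Membership.Propositional using (_∈_; _∉_)
open import Data.List.Membership.Propositional.Properties using (∈-++⁺ˡ; ∈-++⁺ʳ; ∈-++⁻; ∈-∃++; ∈-allFin)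
import Data.List.Membership.DecPropositional as DecMembership
open import Data.List.Relation.Unary.Any using (here; there; index; _─_)
import Data.List.Relation.Unary.Any.Properties as Any
import Data.List.Relation.Unary.All as All
import Data.List.Relation.Unary.All.Properties as All
open import Data.List.Relation.Unary.All using ([])
open import Data.List.Relation.Unary.AllPairs using ([]; _∷_)
open import Data.List.Relation.Unary.Unique.Propositional using (Unique)
import Data.List.Relation.Unary.Unique.DecPropositional as DecUnique
open import Data.List.Relation.Binary.Disjoint.Propositional using (Disjoint)
import Data.List.Relation.Binary.Permutation.Setoid as Perm
import Data.List.Relation.Binary.Permutation.Setoid.Properties as Perm
open import Data.List.Relation.Binary.Prefix.Heterogeneous using (Prefix; []; _∷_)
open import Data.List.Relation.Binary.Infix.Heterogeneous using (Infix; here; there)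
open import Data.List.Relation.Binary.Sublist.Propositional
  using (_⊆_; []; _∷_; _∷ʳ_; minimum; from∈; lookup; ⊆-refl; ⊆-antisym)
open import Data.List.Relation.Binary.Sublist.Propositional.Properties using (++⁺; ++⁺ˡ; ∷⁻; ∷ʳ⁻; reverse⁻)
import Data.List.Relation.Binary.Sublist.DecPropositional as DecSublist
open import Relation.Nullary using (¬_; Dec; yes; no)
open import Relation.Nullary.Decidable using (map′; _×-dec_; _⊎-dec_; _→-dec_; ¬?; decidable-stable)
open import Relation.Unary using (Decidable)
open import Relation.Binary using (DecidableEquality; IsPartialOrder)
open import Relation.Binary.PropositionalEquality
  using (_≡_; _≢_; refl; sym; trans; cong; subst; isEquivalence; module ≡-Reasoning)
open import Relation.Binary.PropositionalEquality.Properties using (setoid)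
open import Induction.WellFounded using (WellFounded; Acc; acc)

private variable
  a ℓ p r q : Level
  A B : Set a

-- Chains

module _ {R : A → A → Set r} where

  chain-uncons : ∀ {x y xs} → Chain R x y xs → ∃[ ys ] xs ≡ x ∷ ys
  chain-uncons (here _)    = [] , refl
  chain-uncons (there _ _) = _ , refl

  chain-unsnoc : ∀ {x y xs} → Chain R x y xs → ∃[ ys ] xs ≡ ys ++ y ∷ []
  chain-unsnoc (here _) = [] , refl
  chain-unsnoc (there {a = x} _ c) with ys , refl ← chain-unsnoc c = x ∷ ys , refl

  same-first : ∀ {Q : A → A → Set q} {x x′ y y′ xs} → Chain R x y xs → Chain Q x′ y′ xs → x ≡ x′
  same-first (here _)    (here _)    = refl
  same-first (here _)    (there _ ())
  same-first (there _ _) (there _ _) = refl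

  first∈ : ∀ {x y xs} → Chain R x y xs → x ∈ xs
  first∈ (here _)    = here refl
  first∈ (there _ _) = here refl

  last∈ : ∀ {x y xs} → Chain R x y xs → y ∈ xs
  last∈ (here _)    = here refl
  last∈ (there _ c) = there (last∈ c)

  chain-tail : ∀ {x v y xs} → Chain R x y (x ∷ v ∷ xs) → R x v × Chain R v y (v ∷ xs)
  chain-tail (there r c@(here _))    = r , c
  chain-tail (there r c@(there _ _)) = r , c

  chain-step : ∀ {x y xs} → x ≢ y → Chain R x y (x ∷ xs) →
               ∃₂ λ v ys → xs ≡ v ∷ ys × R x v × Chain R v y (v ∷ ys)
  chain-step x≢y (here _) = ⊥-elim (x≢y refl)
  chain-step x≢y c@(there _ c′) with _ , refl ← chain-uncons c′ = _ , _ , refl , chain-tail c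

  chain-interior : ∀ {x y xs} → x ≢ y → Chain R x y (x ∷ xs) → ∃[ inner ] xs ≡ inner ++ y ∷ []
  chain-interior x≢y c with chain-unsnoc c
  ... | []        , eq = ⊥-elim (x≢y (∷-injectiveˡ eq))
  ... | _ ∷ inner , eq = inner , ∷-injectiveʳ eq

  chain-split : ∀ {x y v xs} → Chain R x y xs → v ∈ xs →
                ∃₂ λ p q → xs ≡ p ++ v ∷ q × Chain R x v (p ++ v ∷ []) × Chain R v y (v ∷ q)
  chain-split c@(here _)    (here refl) = [] , [] , refl , c , c
  chain-split c@(there _ _) (here refl) = [] , _ , refl , here _ , c
  chain-split (there r c)   (there v∈)  with p , q , refl , c₁ , c₂ ← chain-split c v∈ =
    _ ∷ p , q , refl , there r c₁ , c₂

  chain-take : ∀ {x y v} p {q} → Chain R x y (p ++ v ∷ q) → Chain R x v (p ++ v ∷ [])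
  chain-take []               (here _)    = here _
  chain-take []               (there _ _) = here _
  chain-take (_ ∷ [])         (there r c) = there r (chain-take [] c)
  chain-take (_ ∷ p@(_ ∷ _)) (there r c) = there r (chain-take p c)

  chain-drop : ∀ {x y v} p {q} → Chain R x y (p ++ v ∷ q) → Chain R v y (v ∷ q)
  chain-drop []               c@(here _)    = c
  chain-drop []               c@(there _ _) = c
  chain-drop (_ ∷ [])         (there r c)   = chain-drop [] c
  chain-drop (_ ∷ p@(_ ∷ _)) (there r c)   = chain-drop p c

  chain-++ : ∀ {x v y xs ys} → Chain R x v xs → Chain R v y (v ∷ ys) → Chain R x y (xs ++ ys)
  chain-++ (here _)    c₂ = c₂
  chain-++ (there r c) c₂ = there r (chain-++ c c₂)

  chain-++-via : ∀ {x u v y xs ys} → Chain R x u xs → R u v → Chain R v y ys → Chain R x y (xs ++ ys)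
  chain-++-via c₁ r c₂ with _ , refl ← chain-uncons c₂ = chain-++ c₁ (there r c₂)

  chain-snoc : ∀ {x v y xs} → Chain R x v xs → R v y → Chain R x y (xs ++ y ∷ [])
  chain-snoc c r = chain-++-via c r (here _)

  chain-detour : ∀ {x v y inner ys} → Chain R x v (x ∷ inner ++ v ∷ []) → Chain R v y ys → Chain R x y (x ∷ inner ++ ys)
  chain-detour {x} {v} {inner = inner} d c with ys , refl ← chain-uncons c =
    subst (Chain R x _) (cong (x ∷_) (++-assoc inner (v ∷ []) ys)) (chain-++ d c)

  chain-pred : ∀ {x y v xs} → Chain R x y xs → v ∈ xs → v ≡ x ⊎ ∃[ u ] (R u v × u ∈ xs)
  chain-pred (here _)    (here refl) = inj₁ refl
  chain-pred (there _ _) (here refl) = inj₁ refl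
  chain-pred (there r c) (there v∈)  with chain-pred c v∈
  ... | inj₁ refl          = inj₂ (_ , r , here refl)
  ... | inj₂ (u , ruv , u∈) = inj₂ (u , ruv , there u∈)

  chain-succ : ∀ {x y v xs} → Chain R x y xs → v ∈ xs → v ≡ y ⊎ ∃[ w ] (R v w × w ∈ xs)
  chain-succ (here _)    (here refl) = inj₁ refl
  chain-succ (there r c) (here refl) = inj₂ (_ , r , there (first∈ c))
  chain-succ (there r c) (there v∈)  with chain-succ c v∈
  ... | inj₁ eq = inj₁ eq
  ... | inj₂ (w , rvw , w∈) = inj₂ (w , rvw , there w∈)

  chain-crossing : ∀ {P : A → Set p} → Decidable P → ∀ {x y xs} → Chain R x y xs → ¬ P x → P y →
                   ∃₂ λ u v → R u v × ¬ P u × P v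
  chain-crossing P? (here _) ¬px py = ⊥-elim (¬px py)
  chain-crossing P? (there {b = v} r c) ¬px py with P? v
  ... | yes pv  = _ , v , r , ¬px , pv
  ... | no ¬pv = chain-crossing P? c ¬pv py

chain-map : ∀ {R : A → A → Set r} {Q : A → A → Set q} → (∀ {x y} → R x y → Q x y) →
            ∀ {x y xs} → Chain R x y xs → Chain Q x y xs
chain-map f (here _)    = here _
chain-map f (there r c) = there (f r) (chain-map f c)

chain-reverse : ∀ {R : A → A → Set r} {x y xs} → Chain R x y xs → Chain (flip R) y x (reverse xs)
chain-reverse (here _) = here _
chain-reverse {R = R} (there {a = x} {xs = xs} r c) =
  subst (Chain (flip R) _ _) (sym (unfold-reverse x xs)) (chain-snoc (chain-reverse c) r)

chain-prefix : ∀ {R : A → A → Set r} {Q : A → A → Set q} {x y a b xs ys} → Chain Q a b xs → Chain R x y (ys ++ xs) →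
               Chain R x a (ys ++ a ∷ [])
chain-prefix {ys = ys} c d with _ , refl ← chain-uncons c = chain-take ys d

chain-suffix : ∀ {R : A → A → Set r} {Q : A → A → Set q} {x y a b xs ys} → Chain Q a b xs → Chain R x y (xs ++ ys) →
               Chain R b y (b ∷ ys)
chain-suffix {R = R} {b = b} {ys = ys} c d with xs′ , refl ← chain-unsnoc c =
  chain-drop xs′ (subst (Chain R _ _) (++-assoc xs′ (b ∷ []) ys) d)

chain-image : ∀ {R : A → A → Set r} {Q : B → B → Set q} (f : A → B) →
              (∀ {x y} → R x y → f x ≡ f y ⊎ Q (f x) (f y)) →
              ∀ {x y xs} → Chain R x y xs → ∃[ ys ] Chain Q (f x) (f y) ys
chain-image f step (here x) = _ , here (f x)
chain-image {Q = Q} f step {y = y} (there r c) with step r | chain-image f step c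
... | inj₁ eq | ys , c′ = ys , subst (λ z → Chain Q z (f y) ys) (sym eq) c′
... | inj₂ e  | ys , c′ = _ , there e c′

chain? : ∀ {R : A → A → Set r} → (∀ x y → Dec (R x y)) → DecidableEquality A →
         ∀ x y xs → Dec (Chain R x y xs)
chain? R? _≟_ x y []           = no λ ()
chain? R? _≟_ x y (v ∷ [])     = map′ (λ { (refl , refl) → here x }) (λ { (here _) → refl , refl })
                                       ((x ≟ v) ×-dec (x ≟ y))
chain? R? _≟_ x y (v ∷ w ∷ xs) = map′ (λ { (refl , r , c) → there r c }) (λ { c@(there _ _) → refl , chain-tail c })
                                       ((x ≟ v) ×-dec R? x w ×-dec chain? R? _≟_ w y (w ∷ xs))

module _ {R : A → A → Set r} where

  prefix-unextendable : ∀ {x y u v xs ys} → Chain R x y xs → Chain R u v ys → (∀ w → ¬ R y w) →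
                        Prefix _≡_ xs ys → xs ≡ ys
  prefix-unextendable (here _)    (here _)    _      (refl ∷ [])  = refl
  prefix-unextendable (here _)    (there r _) ¬succ (refl ∷ [])  = ⊥-elim (¬succ _ r)
  prefix-unextendable (there _ c) (there _ d) ¬succ (refl ∷ pre) = cong (_ ∷_) (prefix-unextendable c d ¬succ pre)
  prefix-unextendable (there _ (here _))    (here _) _ (refl ∷ ())
  prefix-unextendable (there _ (there _ _)) (here _) _ (refl ∷ ())

  infix-unextendable : ∀ {x y u v xs ys} → Chain R x y xs → Chain R u v ys →
                       (∀ w → ¬ R w x) → (∀ w → ¬ R y w) → Infix _≡_ xs ys → xs ≡ ys
  infix-unextendable c d _ ¬succ (here pre) = prefix-unextendable c d ¬succ pre
  infix-unextendable (here _)    (here _) _ _ (there (here ()))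
  infix-unextendable (there _ _) (here _) _ _ (there (here ()))
  infix-unextendable c (there r d) ¬pred ¬succ (there inf)
    with refl ← infix-unextendable c d ¬pred ¬succ inf
    with refl ← same-first c d = ⊥-elim (¬pred _ r)

  unextendable-chains-equal : (∀ {x v w} → R x v → R x w → v ≡ w) →
    ∀ {x y y′ xs ys} → Chain R x y xs → Chain R x y′ ys → (∀ w → ¬ R y w) → (∀ w → ¬ R y′ w) → xs ≡ ys
  unextendable-chains-equal det (here _)    (here _)    _      _       = refl
  unextendable-chains-equal det (here _)    (there r _) ¬succ _       = ⊥-elim (¬succ _ r)
  unextendable-chains-equal det (there r _) (here _)    _      ¬succ′ = ⊥-elim (¬succ′ _ r)
  unextendable-chains-equal det (there r c) (there r′ d) ¬succ ¬succ′
    with refl ← det r r′ = cong (_ ∷_) (unextendable-chains-equal det c d ¬succ ¬succ′)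

  maximal-chain-into : ∀ {_<_ : A → A → Set ℓ} → WellFounded _<_ → (∀ {u v} → R u v → u < v) →
                       (∀ v → Dec (∃[ u ] R u v)) → ∀ z → ∃₂ λ h xs → (∀ w → ¬ R w h) × Chain R h z xs
  maximal-chain-into {_<_ = _<_} wf R⇒< pred? z = go z (wf z)
    where
    go : ∀ z → Acc _<_ z → ∃₂ λ h xs → (∀ w → ¬ R w h) × Chain R h z xs
    go z (acc rs) with pred? z
    ... | no none      = z , _ , (λ w r → none (w , r)) , here z
    ... | yes (u , r) with h , _ , ¬pred , c ← go u (rs (R⇒< r)) = h , _ , ¬pred , chain-snoc c r

unextendable-sources-equal : ∀ {R : A → A → Set r} → (∀ {u v x} → R u x → R v x → u ≡ v) →
  ∀ {x x′ z xs ys} → Chain R x z xs → Chain R x′ z ys → (∀ w → ¬ R w x) → (∀ w → ¬ R w x′) → x ≡ x′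
unextendable-sources-equal {R = R} det {xs = xs} {ys = ys} c d ¬pred ¬pred′ =
  same-first c (subst (Chain R _ _) (sym xs≡ys) d)
  where
  xs≡ys : xs ≡ ys
  xs≡ys = reverse-injective (unextendable-chains-equal {R = flip R} det (chain-reverse c) (chain-reverse d) ¬pred ¬pred′)

reverse-detour : ∀ {A : Set a} (x y : A) inner → reverse (y ∷ inner ++ x ∷ []) ≡ x ∷ reverse inner ++ y ∷ []
reverse-detour x y inner = begin
  reverse (y ∷ inner ++ x ∷ [])       ≡⟨ unfold-reverse y (inner ++ x ∷ []) ⟩
  reverse (inner ++ x ∷ []) ++ y ∷ [] ≡⟨ cong (_++ y ∷ []) (reverse-++ inner (x ∷ [])) ⟩
  x ∷ reverse inner ++ y ∷ []          ∎
  where open ≡-Reasoning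

prefix-refl : ∀ {A : Set a} (xs : List A) → Prefix _≡_ xs xs
prefix-refl []       = []
prefix-refl (x ∷ xs) = refl ∷ prefix-refl xs

prefix-++ : ∀ {A : Set a} (xs ys : List A) → Prefix _≡_ xs (xs ++ ys)
prefix-++ []       ys = []
prefix-++ (x ∷ xs) ys = refl ∷ prefix-++ xs ys

concat-snoc : ∀ {A : Set a} (xss : List (List A)) xs → concat (xss ++ xs ∷ []) ≡ concat xss ++ xs
concat-snoc xss xs = trans (sym (concat-++ xss (xs ∷ []))) (cong (concat xss ++_) (++-identityʳ xs))

module _ {A : Set a} where

  unique-++⁻ : ∀ (xs : List A) {ys} → Unique (xs ++ ys) → Unique xs × Unique ys × Disjoint xs ys
  unique-++⁻ []       u         = [] , u , λ { (() , _) }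
  unique-++⁻ (x ∷ xs) (x∉ ∷ u) with uxs , uys , disjoint ← unique-++⁻ xs u =
    All.++⁻ˡ xs x∉ ∷ uxs , uys ,
    λ { (here refl , v∈ys) → All.lookup x∉ (∈-++⁺ʳ xs v∈ys) refl ; (there v∈xs , v∈ys) → disjoint (v∈xs , v∈ys) }

  unique-split : ∀ (xs : List A) {v ys} → Unique (xs ++ v ∷ ys) → Unique (xs ++ v ∷ []) × Disjoint (xs ++ v ∷ []) ys
  unique-split xs {v} {ys} u with uxs , _ , disjoint ← unique-++⁻ (xs ++ v ∷ []) (subst Unique (sym (++-assoc xs _ ys)) u) =
    uxs , disjoint

  unique-last∉ : ∀ (xs : List A) {y} → Unique (xs ++ y ∷ []) → y ∉ xs
  unique-last∉ xs u y∈xs = proj₂ (proj₂ (unique-++⁻ xs u)) (y∈xs , here refl)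

  unique-reverse : ∀ {xs : List A} → Unique xs → Unique (reverse xs)
  unique-reverse {xs} = Perm.Unique-resp-↭ (setoid A) (Perm.↭-sym (setoid A) (Perm.↭-reverse (setoid A) xs))

  ∈-take : ∀ (xs : List A) {v y ys} → v ∈ xs ++ y ∷ [] → v ∈ xs ++ y ∷ ys
  ∈-take xs {ys = ys} v∈ = subst (_ ∈_) (++-assoc xs _ ys) (∈-++⁺ˡ v∈)

  ∈-─ : ∀ {x y : A} {ys} (x∈ : x ∈ ys) → y ∈ ys → y ≢ x → y ∈ (ys ─ x∈)
  ∈-─ (here refl) (here refl) y≢x = ⊥-elim (y≢x refl)
  ∈-─ (here _)    (there y∈)  _   = y∈
  ∈-─ (there _)   (here refl) _   = here refl
  ∈-─ (there x∈)  (there y∈)  y≢x = there (∈-─ x∈ y∈ y≢x)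

  unique-length : ∀ {xs ys : List A} → Unique xs → (∀ {y} → y ∈ xs → y ∈ ys) → length xs ≤ length ys
  unique-length {[]}     _         _      = z≤n
  unique-length {x ∷ xs} {ys} (x∉ ∷ u) xs⊆ys = subst (suc (length xs) ≤_) (sym (length-removeAt′ ys (index x∈)))
    (s≤s (unique-length u λ y∈ → ∈-─ x∈ (xs⊆ys (there y∈)) (All.lookup x∉ y∈ ∘ sym)))
    where
    x∈ : x ∈ ys
    x∈ = xs⊆ys (here refl)

any-bounded-list? : ∀ {m} (P : List (Fin m) → Set p) → (∀ xs → Dec (P xs)) → ∀ k → Dec (∃[ xs ] (length xs ≤ k × P xs))
any-bounded-list? P P? zero = map′ (λ p → [] , z≤n , p) (λ { ([] , _ , p) → p }) (P? [])
any-bounded-list? P P? (suc k) = map′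
  (λ { (inj₁ p) → [] , z≤n , p ; (inj₂ (x , xs , le , p)) → x ∷ xs , s≤s le , p })
  (λ { ([] , _ , p) → inj₁ p ; (x ∷ xs , s≤s le , p) → inj₂ (x , xs , le , p) })
  (P? [] ⊎-dec Fin.any? λ x → any-bounded-list? (P ∘ (x ∷_)) (P? ∘ (x ∷_)) k)

-- Walks that avoid a given subsequence

⊆-skip : ∀ {A : Set a} (inner : List A) {y ys zs} → y ∉ inner → y ∷ ys ⊆ inner ++ zs → y ∷ ys ⊆ zs
⊆-skip []          _  sub         = sub
⊆-skip (_ ∷ _)     y∉ (eq ∷ _)    = ⊥-elim (y∉ (here eq))
⊆-skip (_ ∷ inner) y∉ (_ ∷ʳ sub) = ⊆-skip inner (y∉ ∘ there) sub

⊈⇒nonempty : ∀ {A : Set a} {ys zs : List A} → ¬ ys ⊆ zs → ∃₂ λ y ys′ → ys ≡ y ∷ ys′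
⊈⇒nonempty {ys = []}     ys⊈ = ⊥-elim (ys⊈ (minimum _))
⊈⇒nonempty {ys = y ∷ ys} _   = y , ys , refl

module _ {A : Set a} (_≟_ : DecidableEquality A) where

  residual : A → List A → List A
  residual x []       = []
  residual x (y ∷ ys) with x ≟ y
  ... | yes _ = ys
  ... | no  _ = y ∷ ys

  residual-⊆⁺ : ∀ x ys {zs} → residual x ys ⊆ zs → ys ⊆ x ∷ zs
  residual-⊆⁺ x []       _   = minimum _
  residual-⊆⁺ x (y ∷ ys) sub with x ≟ y
  ... | yes refl = refl ∷ sub
  ... | no  _    = x ∷ʳ sub

  residual-⊆⁻ : ∀ x ys {zs} → ys ⊆ x ∷ zs → residual x ys ⊆ zs
  residual-⊆⁻ x []       _   = minimum _
  residual-⊆⁻ x (y ∷ ys) sub with x ≟ y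
  ... | yes refl = ∷⁻ sub
  ... | no  x≢y  = ∷ʳ⁻ (x≢y ∘ sym) sub

  module _ {E : A → A → Set r} where

    Bypassable : A → A → Set (a ⊔ r)
    Bypassable x y = ∀ z → ∃[ inner ] (Chain E x y (x ∷ inner ++ y ∷ []) × z ∉ inner)

    avoiding-walk : ∀ {x y xs} → Chain Bypassable x y xs → ∀ {ys} → ¬ ys ⊆ xs →
                    ∃[ w ] (Chain E x y w × ¬ ys ⊆ w × (∀ {v} → v ∈ xs → v ∈ w))
    avoiding-walk (here x) ys⊈ = x ∷ [] , here x , ys⊈ , id
    avoiding-walk (there {a = x} {xs = xs} bypass c) {ys} ys⊈
      with w , walk , rest⊈w , xs⊆w ← avoiding-walk c (ys⊈ ∘ residual-⊆⁺ x ys)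
      with r , _ , eq ← ⊈⇒nonempty rest⊈w
      with inner , detour , r∉inner ← bypass r
      = x ∷ inner ++ w , chain-detour detour walk , ys⊈detour , covers
      where
      ys⊈detour : ¬ ys ⊆ x ∷ inner ++ w
      ys⊈detour = rest⊈w ∘ subst (_⊆ w) (sym eq) ∘ ⊆-skip inner r∉inner ∘ subst (_⊆ inner ++ w) eq ∘ residual-⊆⁻ x ys
      covers : ∀ {v} → v ∈ x ∷ xs → v ∈ x ∷ inner ++ w
      covers (here refl) = here refl
      covers (there v∈)  = there (∈-++⁺ʳ inner (xs⊆w v∈))

-- Dominance

module Dominance (G : STGraph) where
  open STGraph G
  open DecMembership (_≟_ {n}) using (_∈?_)

  walk→path : ∀ {x y w} → Walk x y w → ∃[ p ] (Path x y p × (∀ {v} → v ∈ p → v ∈ w))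
  walk→path (here x) = x ∷ [] , (here x , [] ∷ []) , id
  walk→path (there {a = x} e c) with p , (walk , u) , p⊆w ← walk→path c with x ∈? p
  ... | no x∉p = x ∷ p , (there e walk , All.¬Any⇒All¬ p x∉p ∷ u) ,
                 λ { (here eq) → here eq ; (there v∈) → there (p⊆w v∈) }
  ... | yes x∈p with p₁ , q , refl , _ , suffix ← chain-split walk x∈p =
    x ∷ q , (suffix , proj₁ (proj₂ (unique-++⁻ p₁ u))) ,
    λ { (here eq) → here eq ; (there v∈) → there (p⊆w (∈-++⁺ʳ p₁ (there v∈))) }

  path-length : ∀ {x y p} → Path x y p → length p ≤ n
  path-length {p = p} (_ , u) = subst (length p ≤_) (length-tabulate id) (unique-length u λ _ → ∈-allFin _)

  path? : ∀ x y p → Dec (Path x y p)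
  path? x y p = chain? (λ u v → E u v Bool.≟ true) _≟_ x y p ×-dec DecUnique.unique? _≟_ p

  path-split : ∀ {x y v p} → Path x y p → v ∈ p →
               ∃₂ λ p₁ p₂ → p ≡ p₁ ++ v ∷ p₂ × Path x v (p₁ ++ v ∷ []) × Path v y (v ∷ p₂)
  path-split (walk , u) v∈ with p₁ , p₂ , refl , prefix , suffix ← chain-split walk v∈ =
    p₁ , p₂ , refl , (prefix , proj₁ (unique-split p₁ u)) , (suffix , proj₁ (proj₂ (unique-++⁻ p₁ u)))

  prefix-path : ∀ {x y v} p {q} → Path x y (p ++ v ∷ q) → Path x v (p ++ v ∷ [])
  prefix-path p (walk , u) = chain-take p walk , proj₁ (unique-split p u)

  path-disjoint : ∀ {x y v} p₁ {p₂} → Path x y (p₁ ++ v ∷ p₂) → Disjoint (p₁ ++ v ∷ []) p₂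
  path-disjoint p₁ (_ , u) = proj₂ (unique-split p₁ u)

  walk-sdom : ∀ {u v w} → SDom G u v → Walk s v w → u ∈ w
  walk-sdom u-dom walk with p , path , p⊆w ← walk→path walk = p⊆w (u-dom p path)

  walk-tdom : ∀ {u v w} → TDom G u v → Walk v t w → u ∈ w
  walk-tdom u-dom walk with p , path , p⊆w ← walk→path walk = p⊆w (u-dom p path)

  sdom-or-avoiding-path : ∀ u v → SDom G u v ⊎ ∃[ p ] (Path s v p × u ∉ p)
  sdom-or-avoiding-path u v
    with any-bounded-list? (λ p → Path s v p × u ∉ p) (λ p → path? s v p ×-dec ¬? (u ∈? p)) n
  ... | yes (p , _ , avoiding) = inj₂ (p , avoiding)
  ... | no none = inj₁ λ p path → decidable-stable (u ∈? p) λ u∉p → none (p , path-length path , path , u∉p)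

  sdom? : ∀ u v → Dec (SDom G u v)
  sdom? u v with sdom-or-avoiding-path u v
  ... | inj₁ u-dom            = yes u-dom
  ... | inj₂ (p , path , u∉p) = no λ u-dom → u∉p (u-dom p path)

  sdom-refl : ∀ {v} → SDom G v v
  sdom-refl _ (walk , _) = last∈ walk

  source-sdom : ∀ {v} → SDom G s v
  source-sdom _ (walk , _) = first∈ walk

  sdom-trans : ∀ {x y z} → SDom G x y → SDom G y z → SDom G x z
  sdom-trans x-dom y-dom p path with p₁ , p₂ , refl , prefix , _ ← path-split path (y-dom p path) =
    ∈-take p₁ (x-dom _ prefix)

  sdom-antisym : ∀ {x y} → SDom G x y → SDom G y x → x ≡ y
  sdom-antisym {x} x-dom y-dom with p , path ← reach-s x
    with p₁ , p₂ , refl , prefix , (suffix , _) ← path-split path (y-dom p path) with last∈ suffix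
  ... | here x≡y    = x≡y
  ... | there x∈p₂ = ⊥-elim (path-disjoint p₁ path (x-dom _ prefix , x∈p₂))

  sdom-later : ∀ {d v x} p {q} → SDom G d v → Path s v (p ++ x ∷ q) → d ∈ p → SDom G d x
  sdom-later {d} p d-dom path d∈p r (walk , _) = decidable-stable (d ∈? r) λ d∉r →
    case ∈-++⁻ r (walk-sdom d-dom (chain-++ walk (chain-drop p (proj₁ path)))) of λ where
      (inj₁ d∈r) → d∉r d∈r
      (inj₂ d∈q) → path-disjoint p path (∈-++⁺ˡ d∈p , d∈q)

  sdom-total : ∀ {d₁ d₂ v} → SDom G d₁ v → SDom G d₂ v → SDom G d₁ d₂ ⊎ SDom G d₂ d₁
  sdom-total {d₁} {d₂} {v} d₁-dom d₂-dom with p , path ← reach-s v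
    with p₁ , p₂ , refl ← ∈-∃++ (d₁-dom p path) with ∈-++⁻ p₁ (d₂-dom _ path)
  ... | inj₁ d₂∈p₁          = inj₂ (sdom-later p₁ d₂-dom path d₂∈p₁)
  ... | inj₂ (here refl)     = inj₁ sdom-refl
  ... | inj₂ (there d₂∈p₂) with q₁ , q₂ , refl ← ∈-∃++ d₂∈p₂ =
    inj₁ (sdom-later (p₁ ++ d₁ ∷ q₁) d₁-dom (subst (Path s v) (sym (++-assoc p₁ (d₁ ∷ q₁) (d₂ ∷ q₂))) path)
                     (∈-++⁺ʳ p₁ (here refl)))

  sdom-isPartialOrder : IsPartialOrder _≡_ (SDom G)
  sdom-isPartialOrder = record
    { isPreorder = record { isEquivalence = isEquivalence ; reflexive = λ { refl → sdom-refl } ; trans = sdom-trans }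
    ; antisym    = sdom-antisym
    }

  _⊏_ : V G → V G → Set
  x ⊏ y = SDom G x y × x ≢ y

  ⊏? : ∀ x y → Dec (x ⊏ y)
  ⊏? x y = sdom? x y ×-dec ¬? (x ≟ y)

  ⊏-wellFounded : WellFounded _⊏_
  ⊏-wellFounded = po-wellFounded sdom-isPartialOrder

  ⊏-noetherian : WellFounded (flip _⊏_)
  ⊏-noetherian = po-noetherian sdom-isPartialOrder

  sdom-chain-split : ∀ {x z L w} → Chain _⊏_ x z (x ∷ L) → Walk s z w →
                     ∃₂ λ w₁ w₂ → w ≡ w₁ ++ w₂ × Walk s x w₁ × L ⊆ w₂
  sdom-chain-split {w = w} (here _) walk = w , [] , sym (++-identityʳ w) , walk , []
  sdom-chain-split {x} (there {b = y} (x-dom , x≢y) c) walk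
    with _ , refl ← chain-uncons c
    with w₁ , w₂ , refl , walk₁ , L⊆w₂ ← sdom-chain-split c walk
    with p , q , refl , prefix , segment ← chain-split walk₁ (walk-sdom x-dom walk₁)
    with inner , refl ← chain-interior x≢y segment
    = p ++ x ∷ [] , inner ++ y ∷ w₂ , regroup , prefix , ++⁺ˡ inner (refl ∷ L⊆w₂)
    where
    regroup : (p ++ x ∷ inner ++ y ∷ []) ++ w₂ ≡ (p ++ x ∷ []) ++ inner ++ y ∷ w₂
    regroup = begin
      (p ++ x ∷ inner ++ y ∷ []) ++ w₂ ≡⟨ ++-assoc p _ w₂ ⟩
      p ++ x ∷ (inner ++ y ∷ []) ++ w₂ ≡⟨ cong (λ r → p ++ x ∷ r) (++-assoc inner _ w₂) ⟩
      p ++ x ∷ inner ++ y ∷ w₂         ≡⟨ ++-assoc p _ _ ⟨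
      (p ++ x ∷ []) ++ inner ++ y ∷ w₂ ∎
      where open ≡-Reasoning

  sdom-chain-sublist : ∀ {z A w} → Chain _⊏_ s z A → Walk s z w → A ⊆ w
  sdom-chain-sublist c walk with _ , refl ← chain-uncons c with _ , _ , refl , walk₁ , L⊆w₂ ← sdom-chain-split c walk =
    ++⁺ (from∈ (first∈ walk₁)) L⊆w₂

  sparent⇒⊏ : ∀ {p v} → SParent G p v → p ⊏ v
  sparent⇒⊏ (_ , p≢v , p-dom , _) = p-dom , p≢v

  sparent-unique : ∀ {p q v} → SParent G p v → SParent G q v → p ≡ q
  sparent-unique (_ , p≢v , p-dom , p-max) (_ , q≢v , q-dom , q-max) =
    sdom-antisym (q-max _ p≢v p-dom) (p-max _ q≢v q-dom)

  sparent? : ∀ p v → Dec (SParent G p v)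
  sparent? p v = ¬? (v ≟ s) ×-dec ¬? (p ≟ v) ×-dec sdom? p v ×-dec
                 Fin.all? λ d → ¬? (d ≟ v) →-dec sdom? d v →-dec sdom? d p

  sparent-exists : ∀ {v} → v ≢ s → ∃[ p ] SParent G p v
  sparent-exists {v} v≢s = climb s (⊏-noetherian s) (source-sdom , v≢s ∘ sym)
    where
    climb : ∀ m → Acc (flip _⊏_) m → m ⊏ v → ∃[ p ] SParent G p v
    climb m (acc higher) (m-dom , m≢v) with Fin.any? (λ d → ⊏? d v ×-dec ⊏? m d)
    ... | yes (d , d⊏v , m⊏d) = climb d (higher m⊏d) d⊏v
    ... | no none = m , v≢s , m≢v , m-dom , λ d d≢v d-dom → below-m d-dom d≢v
      where
      below-m : ∀ {d} → SDom G d v → d ≢ v → SDom G d m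
      below-m {d} d-dom d≢v with sdom-total d-dom m-dom | m ≟ d
      ... | inj₁ d≤m | _        = d≤m
      ... | inj₂ _   | yes refl = sdom-refl
      ... | inj₂ m≤d | no m≢d   = ⊥-elim (none (d , (d-dom , d≢v) , (m≤d , m≢d)))

  s-tree-path : ∀ v → ∃[ L ] Chain (SParent G) s v L
  s-tree-path v = go v (⊏-wellFounded v)
    where
    go : ∀ v → Acc _⊏_ v → ∃[ L ] Chain (SParent G) s v L
    go v (acc lower) with v ≟ s
    ... | yes refl = _ , here s
    ... | no v≢s with p , sp ← sparent-exists v≢s with L , c ← go p (lower (sparent⇒⊏ sp)) = _ , chain-snoc c sp

  sink-last : ∀ {x y w} → Walk x y w → t ∈ w → t ≡ y
  sink-last (here _)    (here refl) = refl
  sink-last (there e _) (here refl) with () ← trans (sym e) (t-sink _)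
  sink-last (there _ c) (there t∈)  = sink-last c t∈

  ¬sparent-sink : ∀ {y} → ¬ SParent G t y
  ¬sparent-sink {y} (_ , t≢y , t-dom , _) with p , path ← reach-s y = t≢y (sink-last (proj₁ path) (t-dom p path))

  sparent-segment : ∀ {x y P} → SParent G x y → Path s y P →
                    ∃₂ λ p inner → P ≡ p ++ x ∷ inner ++ y ∷ [] × Walk x y (x ∷ inner ++ y ∷ [])
  sparent-segment (_ , x≢y , x-dom , _) path with p , q , refl , _ , (segment , _) ← path-split path (x-dom _ path)
    with inner , refl ← chain-interior x≢y segment = p , inner , refl , segment

  segment-avoids-sdominators : ∀ {x y d} p inner → SParent G x y → Path s y (p ++ x ∷ inner ++ y ∷ []) →
                               SDom G d y → d ∉ inner
  segment-avoids-sdominators {x} {y} {d} p inner (_ , _ , _ , x-max) path d-dom d∈inner with d ≟ y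
  ... | yes refl = unique-last∉ (p ++ x ∷ inner) (subst Unique (sym (++-assoc p _ _)) (proj₂ path)) (∈-++⁺ʳ p (there d∈inner))
  ... | no d≢y   = path-disjoint p path (x-max d d≢y d-dom _ (prefix-path p path) , ∈-++⁺ˡ d∈inner)

  sparent-bypassable : ∀ {x y} → SParent G x y → Bypassable _≟_ {E = Edge} x y
  sparent-bypassable {x} {y} sp z with sdom-or-avoiding-path z y
  ... | inj₁ z-dom with P , path ← reach-s y with p , inner , refl , segment ← sparent-segment sp path =
    inner , segment , segment-avoids-sdominators p inner sp path z-dom
  ... | inj₂ (P , path , z∉P) with p , inner , refl , segment ← sparent-segment sp path =
    inner , segment , z∉P ∘ ∈-++⁺ʳ p ∘ there ∘ ∈-++⁺ˡ

  -- If a y-t path avoided e, then e would lie strictly inside the segment from a to y of every s-y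
  -- path, so e would s-dominate y from inside that segment.
  tparent-tdom-schild : ∀ {e a y} → TParent G e a → SParent G a y → TDom G e y
  tparent-tdom-schild {e} {a} {y} (_ , e≢a , e-dom , _) sp q (q-walk , _) = decidable-stable (e ∈? q) absurd
    where
    e∈interior : e ∉ q → ∀ {inner} → Walk a y (a ∷ inner ++ y ∷ []) → e ∈ inner
    e∈interior e∉q {inner} segment with walk-tdom e-dom (chain-detour segment q-walk)
    ... | here e≡a = ⊥-elim (e≢a e≡a)
    ... | there e∈ with ∈-++⁻ inner e∈
    ...   | inj₁ e∈inner = e∈inner
    ...   | inj₂ e∈q     = ⊥-elim (e∉q e∈q)

    absurd : e ∉ q → ⊥
    absurd e∉q with P , path ← reach-s y with p , inner , refl , segment ← sparent-segment sp path =
      segment-avoids-sdominators p inner sp path e-dom-y (e∈interior e∉q segment)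
      where
      e-dom-y : SDom G e y
      e-dom-y _ path′ with p′ , _ , refl , segment′ ← sparent-segment sp path′ =
        ∈-++⁺ʳ p′ (there (∈-++⁺ˡ (e∈interior e∉q segment′)))

-- The reversed graph and post-dominance

-- rev (rev G) agrees with G definitionally on n, E, s and t, which is all that paths, dominance and
-- tree parents depend on; so the conversions below, taken at rev G, also lead from rev G back to G.
rev : STGraph → STGraph
rev G = record
  { n = n ; E = flip E ; s = t ; t = s
  ; s-source = t-sink ; s-unique = t-unique ; t-sink = s-source ; t-unique = s-unique
  ; reach-s = λ v → let xs , walk , u = reach-t v in reverse xs , chain-reverse walk , unique-reverse u
  ; reach-t = λ v → let xs , walk , u = reach-s v in reverse xs , chain-reverse walk , unique-reverse u
  }
  where open STGraph G

reverse-path : ∀ G {x y xs} → STGraph.Path G x y xs → STGraph.Path (rev G) y x (reverse xs)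
reverse-path G (walk , u) = chain-reverse walk , unique-reverse u

tdom⇒sdom-rev : ∀ G {u v} → TDom G u v → SDom (rev G) u v
tdom⇒sdom-rev G u-dom xs path = Any.reverse⁻ (u-dom (reverse xs) (reverse-path (rev G) path))

sdom-rev⇒tdom : ∀ G {u v} → SDom (rev G) u v → TDom G u v
sdom-rev⇒tdom G u-dom xs path = Any.reverse⁻ (u-dom (reverse xs) (reverse-path G path))

tparent⇒sparent-rev : ∀ G {p v} → TParent G p v → SParent (rev G) p v
tparent⇒sparent-rev G (v≢t , p≢v , p-dom , p-max) =
  v≢t , p≢v , tdom⇒sdom-rev G p-dom , λ d d≢v d-dom → tdom⇒sdom-rev G (p-max d d≢v (sdom-rev⇒tdom G d-dom))

sparent-rev⇒tparent : ∀ G {p v} → SParent (rev G) p v → TParent G p v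
sparent-rev⇒tparent G (v≢t , p≢v , p-dom , p-max) =
  v≢t , p≢v , sdom-rev⇒tdom G p-dom , λ d d≢v d-dom → sdom-rev⇒tdom G (p-max d d≢v (tdom⇒sdom-rev G d-dom))

module PostDominance (G : STGraph) where
  open STGraph G
  private module R = Dominance (rev G)

  _⊏ᵗ_ : V G → V G → Set
  x ⊏ᵗ y = TDom G x y × x ≢ y

  tparent⇒⊏ᵗ : ∀ {p v} → TParent G p v → p ⊏ᵗ v
  tparent⇒⊏ᵗ (_ , p≢v , p-dom , _) = p-dom , p≢v

  tdom-chain-sublist : ∀ {z B w} → Chain (flip _⊏ᵗ_) z t B → Walk z t w → B ⊆ w
  tdom-chain-sublist c walk =
    reverse⁻ (R.sdom-chain-sublist (chain-map (λ (p-dom , p≢v) → tdom⇒sdom-rev G p-dom , p≢v) (chain-reverse c))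
                                   (chain-reverse walk))

  tparent-unique : ∀ {p q v} → TParent G p v → TParent G q v → p ≡ q
  tparent-unique tp tq = R.sparent-unique (tparent⇒sparent-rev G tp) (tparent⇒sparent-rev G tq)

  tparent? : ∀ p v → Dec (TParent G p v)
  tparent? p v = map′ (sparent-rev⇒tparent G) (tparent⇒sparent-rev G) (R.sparent? p v)

  t-tree-path : ∀ v → ∃[ L ] Chain (flip (TParent G)) v t L
  t-tree-path v with L , c ← R.s-tree-path v = reverse L , chain-map (sparent-rev⇒tparent G) (chain-reverse c)

  ¬tparent-source : ∀ {y} → ¬ TParent G s y
  ¬tparent-source = R.¬sparent-sink ∘ tparent⇒sparent-rev G

  tparent-bypassable : ∀ {x y} → TParent G y x → Bypassable _≟_ {E = Edge} x y
  tparent-bypassable {x} {y} tp z with inner , detour , z∉inner ← R.sparent-bypassable (tparent⇒sparent-rev G tp) z =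
    reverse inner , subst (Walk x y) (reverse-detour x y inner) (chain-reverse detour) , z∉inner ∘ Any.reverse⁻

  sparent-sdom-tchild : ∀ {f a c} → SParent G f a → TParent G a c → SDom G f c
  sparent-sdom-tchild sp tp =
    tdom⇒sdom-rev (rev G) (R.tparent-tdom-schild (sparent-rev⇒tparent (rev G) sp) (tparent⇒sparent-rev G tp))

-- Univocal paths and the collapsed trees

module Univocality (G : STGraph) where
  open STGraph G
  open Dominance G
  open PostDominance G
  private module R = Dominance (rev G)

  Link : V G → V G → Set
  Link v w = TParent G w v × (∀ c → TParent G w c → c ≡ v) × SParent G v w × (∀ c → SParent G v c → c ≡ w)

  link⇒tparent : ∀ {v w} → Link v w → TParent G w v
  link⇒tparent = proj₁

  link⇒sparent : ∀ {v w} → Link v w → SParent G v w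
  link⇒sparent = proj₁ ∘ proj₂ ∘ proj₂

  link? : ∀ v w → Dec (Link v w)
  link? v w = tparent? w v ×-dec Fin.all? (λ c → tparent? w c →-dec c ≟ v) ×-dec
              sparent? v w ×-dec Fin.all? (λ c → sparent? v c →-dec c ≟ w)

  link-functional : ∀ {v w w′} → Link v w → Link v w′ → w ≡ w′
  link-functional (_ , _ , _ , only-w) (_ , _ , sp′ , _) = sym (only-w _ sp′)

  link-injective : ∀ {v v′ w} → Link v w → Link v′ w → v ≡ v′
  link-injective (_ , only-v , _ , _) (tp′ , _ , _ , _) = sym (only-v _ tp′)

  univocal⇒chain : ∀ {C} → Univocal G C → ∃₂ λ a b → Chain Link a b C
  univocal⇒chain {v ∷ C} u = v , from v C u
    where
    from : ∀ v C → Univocal G (v ∷ C) → ∃[ b ] Chain Link v b (v ∷ C)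
    from v []      _ = v , here v
    from v (w ∷ C) (tp , only-v , sp , only-w , u) with b , c ← from w C u = b , there (tp , only-v , sp , only-w) c

  chain⇒univocal : ∀ {a b C} → Chain Link a b C → Univocal G C
  chain⇒univocal (here _)                                          = tt
  chain⇒univocal (there (tp , only-v , sp , only-w) c@(here _))    = tp , only-v , sp , only-w , tt
  chain⇒univocal (there (tp , only-v , sp , only-w) c@(there _ _)) = tp , only-v , sp , only-w , chain⇒univocal c

  maxUnivocal⇒unextendable : ∀ {a b C} → MaxUnivocal G C → Chain Link a b C →
                             (∀ w → ¬ Link w a) × (∀ w → ¬ Link b w)
  maxUnivocal⇒unextendable {C = C} (_ , maximal) c =
    (λ w l → case ++-identityˡ-unique (w ∷ []) (maximal _ (chain⇒univocal (there l c)) (there (here (prefix-refl C)))) of λ ()) ,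
    (λ w l → case ++-identityʳ-unique C (maximal _ (chain⇒univocal (chain-snoc c l)) (here (prefix-++ C (w ∷ [])))) of λ ())

  maxUnivocal⇒chain : ∀ {C} → MaxUnivocal G C →
                      ∃₂ λ a b → Chain Link a b C × (∀ w → ¬ Link w a) × (∀ w → ¬ Link b w)
  maxUnivocal⇒chain mC with a , b , c ← univocal⇒chain (proj₁ mC) = a , b , c , maxUnivocal⇒unextendable mC c

  unextendable⇒maxUnivocal : ∀ {a b C} → Chain Link a b C → (∀ w → ¬ Link w a) → (∀ w → ¬ Link b w) →
                             MaxUnivocal G C
  unextendable⇒maxUnivocal c ¬pred ¬succ =
    chain⇒univocal c , λ D uD C⊑D → infix-unextendable c (proj₂ (proj₂ (univocal⇒chain uD))) ¬pred ¬succ C⊑D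

  maxUnivocal-unique : ∀ {C D z} → MaxUnivocal G C → MaxUnivocal G D → z ∈ C → z ∈ D → C ≡ D
  maxUnivocal-unique mC mD z∈C z∈D
    with _ , _ , c , ¬pred , ¬succ ← maxUnivocal⇒chain mC
    with _ , _ , d , ¬pred′ , ¬succ′ ← maxUnivocal⇒chain mD
    with _ , _ , refl , c-to-z , _ ← chain-split c z∈C
    with _ , _ , refl , d-to-z , _ ← chain-split d z∈D
    with refl ← unextendable-sources-equal link-injective c-to-z d-to-z ¬pred ¬pred′
    = unextendable-chains-equal link-functional c d ¬succ ¬succ′

  -- Opaque: unfolding this construction inside later types makes type checking blow up.
  opaque
    maxUnivocal-class : ∀ z → ∃[ C ] (MaxUnivocal G C × z ∈ C)
    maxUnivocal-class z
      with _ , _ , ¬pred , into-z ← maximal-chain-into ⊏-wellFounded (sparent⇒⊏ ∘ link⇒sparent)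
                                                       (λ v → Fin.any? λ u → link? u v) z
      with e , _ , ¬succ , from-z ← maximal-chain-into {R = flip Link} R.⊏-wellFounded
                                      (R.sparent⇒⊏ ∘ tparent⇒sparent-rev G ∘ link⇒tparent) (λ v → Fin.any? (link? v)) z
      with ys , eq ← chain-uncons (chain-reverse from-z)
      = _ , unextendable⇒maxUnivocal (chain-++ into-z (subst (Chain Link z e) eq (chain-reverse from-z))) ¬pred ¬succ ,
        ∈-++⁺ˡ (last∈ into-z)

  class : V G → List (V G)
  class z = proj₁ (maxUnivocal-class z)

  class-max : ∀ z → MaxUnivocal G (class z)
  class-max z = proj₁ (proj₂ (maxUnivocal-class z))

  ∈-class : ∀ z → z ∈ class z
  ∈-class z = proj₂ (proj₂ (maxUnivocal-class z))

  collapse-sparent : ∀ {C D x y} → MaxUnivocal G C → MaxUnivocal G D → x ∈ C → y ∈ D → SParent G x y →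
                     C ≡ D ⊎ CSParent G C D
  collapse-sparent {C} {D} mC mD x∈ y∈ sp with ≡-dec _≟_ C D
  ... | yes C≡D = inj₁ C≡D
  ... | no C≢D  = inj₂ (mC , mD , C≢D , _ , _ , x∈ , y∈ , sp)

  collapse-tparent : ∀ {C D x y} → MaxUnivocal G C → MaxUnivocal G D → x ∈ C → y ∈ D → TParent G y x →
                     C ≡ D ⊎ CTParent G D C
  collapse-tparent {C} {D} mC mD x∈ y∈ tp with ≡-dec _≟_ C D
  ... | yes C≡D = inj₁ C≡D
  ... | no C≢D  = inj₂ (mD , mC , C≢D ∘ sym , _ , _ , y∈ , x∈ , tp)

  csparent-ends : ∀ {C′ C a′ b′ a b x y} → MaxUnivocal G C′ → MaxUnivocal G C → C′ ≢ C →
                  Chain Link a′ b′ C′ → Chain Link a b C → x ∈ C′ → y ∈ C → SParent G x y → x ≡ b′ × y ≡ a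
  csparent-ends {C′} {C} {b′ = b′} {a} {x = x} {y} mC′ mC C′≢C c′ c x∈ y∈ sp = x-last , y-first
    where
    x-last : x ≡ b′
    x-last with chain-succ c′ x∈
    ... | inj₁ eq = eq
    ... | inj₂ (w , (_ , _ , _ , only-w) , w∈) =
      ⊥-elim (C′≢C (maxUnivocal-unique mC′ mC (subst (_∈ C′) (sym (only-w _ sp)) w∈) y∈))
    y-first : y ≡ a
    y-first with chain-pred c y∈
    ... | inj₁ eq = eq
    ... | inj₂ (p , (_ , _ , sp′ , _) , p∈) =
      ⊥-elim (C′≢C (maxUnivocal-unique mC′ mC x∈ (subst (_∈ C) (sparent-unique sp′ sp) p∈)))

  ctparent-ends : ∀ {C′ C a′ b′ a b x y} → MaxUnivocal G C′ → MaxUnivocal G C → C′ ≢ C →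
                  Chain Link a′ b′ C′ → Chain Link a b C → x ∈ C′ → y ∈ C → TParent G x y → x ≡ a′ × y ≡ b
  ctparent-ends {C′} {C} {a′} {b = b} {x = x} {y} mC′ mC C′≢C c′ c x∈ y∈ tp = x-first , y-last
    where
    x-first : x ≡ a′
    x-first with chain-pred c′ x∈
    ... | inj₁ eq = eq
    ... | inj₂ (p , (_ , only-p , _ , _) , p∈) =
      ⊥-elim (C′≢C (maxUnivocal-unique mC′ mC (subst (_∈ C′) (sym (only-p _ tp)) p∈) y∈))
    y-last : y ≡ b
    y-last with chain-succ c y∈
    ... | inj₁ eq = eq
    ... | inj₂ (w , (tp′ , _ , _ , _) , w∈) =
      ⊥-elim (C′≢C (maxUnivocal-unique mC′ mC x∈ (subst (_∈ C) (tparent-unique tp′ tp) w∈)))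

  ext-exists : ∀ {u} → MaxUnivocal G u → ∃[ X ] IsExt G u X
  ext-exists mu
    with a , _ , cu , _ ← maxUnivocal⇒chain mu
    with refl ← maxUnivocal-unique (class-max a) mu (∈-class a) (first∈ cu)
    with Cs , s-chain ← chain-image class (collapse-sparent (class-max _) (class-max _) (∈-class _) (∈-class _))
                                      (proj₂ (s-tree-path a))
    with Ds , t-chain ← chain-image class (collapse-tparent (class-max _) (class-max _) (∈-class _) (∈-class _))
                                      (proj₂ (t-tree-path a))
    = _ , class s , Cs , class t , Ds , class-max s , ∈-class s , s-chain , class-max t , ∈-class t , t-chain , refl

  link-chain-source : ∀ {a b C} → Chain Link a b C → s ∈ C → s ≡ a
  link-chain-source c s∈ with chain-pred c s∈
  ... | inj₁ eq = eq
  ... | inj₂ (_ , (_ , _ , (s≢s , _) , _) , _) = ⊥-elim (s≢s refl)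

  link-chain-sink : ∀ {a b C} → Chain Link a b C → t ∈ C → t ≡ b
  link-chain-sink c t∈ with chain-succ c t∈
  ... | inj₁ eq = eq
  ... | inj₂ (_ , ((t≢t , _) , _) , _) = ⊥-elim (t≢t refl)

  flatten-s : ∀ {C′ C Cs a′ b′ a b} → Chain (CSParent G) C′ C Cs → Chain Link a′ b′ C′ → Chain Link a b C →
              Chain (SParent G) a′ b (concat Cs)
  flatten-s (here _) c′ c with refl ← same-first c′ c =
    subst (Chain (SParent G) _ _) (sym (++-identityʳ _)) (chain-map link⇒sparent c)
  flatten-s (there (mC′ , mC″ , C′≢C″ , _ , _ , x∈ , y∈ , sp) rest) c′ c
    with _ , _ , c″ , _ ← maxUnivocal⇒chain mC″
    with refl , refl ← csparent-ends mC′ mC″ C′≢C″ c′ c″ x∈ y∈ sp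
    = chain-++-via (chain-map link⇒sparent c′) sp (flatten-s rest c″ c)

  flatten-t : ∀ {C D Ds a b d e} → Chain (flip (CTParent G)) C D Ds → Chain Link a b C → Chain Link d e D →
              Chain (flip (TParent G)) a e (concat Ds)
  flatten-t (here _) c d with refl ← same-first c d =
    subst (Chain (flip (TParent G)) _ _) (sym (++-identityʳ _)) (chain-map link⇒tparent d)
  flatten-t (there (mC″ , mC , C″≢C , _ , _ , x∈ , y∈ , tp) rest) c d
    with _ , _ , c″ , _ ← maxUnivocal⇒chain mC″
    with refl , refl ← ctparent-ends mC″ mC C″≢C c″ c x∈ y∈ tp
    = chain-++-via (chain-map link⇒tparent c) tp (flatten-t rest c″ d)

  ext-decomposition : ∀ {u a b X} → Chain Link a b u → IsExt G u X →
    ∃₂ λ pre rest → X ≡ (pre ++ u) ++ rest × Chain (SParent G) s b (pre ++ u) × Chain (flip (TParent G)) a t (u ++ rest)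
  ext-decomposition {u} cu (_ , Cs , _ , Ds , m₀ , s∈C₀ , s-chain , mD , t∈D , t-chain , refl)
    with _ , _ , c₀ , _ ← maxUnivocal⇒chain m₀
    with _ , _ , cD , _ ← maxUnivocal⇒chain mD
    with refl ← link-chain-source c₀ s∈C₀
    with refl ← link-chain-sink cD t∈D
    with pre-blocks , refl ← chain-unsnoc s-chain
    with rest-blocks , refl ← chain-uncons t-chain
    = concat pre-blocks , concat rest-blocks , cong (_++ concat rest-blocks) (concat-snoc pre-blocks u) ,
      subst (Chain (SParent G) s _) (concat-snoc pre-blocks u) (flatten-s s-chain c₀ cu) , flatten-t t-chain cu cD

-- Safe sequences

module Safety (G : STGraph) where
  open STGraph G
  open Dominance G
  open PostDominance G

  ⊏⇒path : ∀ {x y} → x ⊏ y → ∃[ p ] Path x y p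
  ⊏⇒path {y = y} (x-dom , _) with _ , path ← reach-s y with _ , _ , refl , _ , suffix ← path-split path (x-dom _ path) =
    _ , suffix

  ⊏ᵗ⇒path : ∀ {x y} → y ⊏ᵗ x → ∃[ p ] Path x y p
  ⊏ᵗ⇒path {x} (y-dom , _) with _ , path ← reach-t x with _ , _ , refl , prefix , _ ← path-split path (y-dom _ path) =
    _ , prefix

  chain⇒sequence : ∀ {x y xs} → Chain (λ u v → ∃[ p ] Path u v p) x y xs → IsSequence G xs
  chain⇒sequence (here _)                = tt
  chain⇒sequence (there r c@(here _))    = r , tt
  chain⇒sequence (there r c@(there _ _)) = r , chain⇒sequence c

  dominator-sequence-safe : ∀ {z A B} → Chain _⊏_ s z A → Chain (flip _⊏ᵗ_) z t (z ∷ B) → Safe G (A ++ B)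
  dominator-sequence-safe {z} {A} {B} s-chain t-chain =
    chain⇒sequence (chain-++ (chain-map ⊏⇒path s-chain) (chain-map ⊏ᵗ⇒path t-chain)) , covered
    where
    covered : ∀ P → IsWalkCover G P → ∃[ w ] (P w × A ++ B ⊆ w)
    covered P (walks , cover) with w , Pw , z∈w ← cover z with p , q , refl , prefix , suffix ← chain-split (walks w Pw) z∈w =
      _ , Pw , subst (A ++ B ⊆_) (++-assoc p (z ∷ []) q)
                     (++⁺ (sdom-chain-sublist s-chain prefix) (∷⁻ (tdom-chain-sublist t-chain suffix)))

  no-insertion : ∀ {X p q c} P Q → MaxSafe G X → X ≡ P ++ Q → Chain _⊏_ s p P → Chain (flip _⊏ᵗ_) q t Q →
                 p ⊏ c → q ⊏ᵗ c → ⊥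
  no-insertion {c = c} P Q (_ , maximal) refl s-chain t-chain p⊏c q⊏c =
    case ++-identityˡ-unique (c ∷ []) (++-cancelˡ P Q (c ∷ Q) (maximal _ longer-safe (++⁺ ⊆-refl (c ∷ʳ ⊆-refl)))) of λ ()
    where
    longer-safe : Safe G (P ++ c ∷ Q)
    longer-safe = subst (Safe G) (++-assoc P (c ∷ []) Q) (dominator-sequence-safe (chain-snoc s-chain p⊏c) (there q⊏c t-chain))

module ExtMaximality (G : STGraph) {u a b} (mu : MaxUnivocal G u) (cu : Chain (Univocality.Link G) a b u) where
  open STGraph G
  open Dominance G
  open PostDominance G
  open Univocality G
  open Safety G
  open DecMembership (_≟_ {n}) using (_∈?_)
  open DecSublist (_≟_ {n}) using (_⊆?_)

  private variable
    pre rest : List (V G)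

  ext-safe : Chain (SParent G) s b (pre ++ u) → Chain (flip (TParent G)) a t (u ++ rest) → Safe G ((pre ++ u) ++ rest)
  ext-safe s-chain t-chain = dominator-sequence-safe (chain-map sparent⇒⊏ s-chain) (chain-map tparent⇒⊏ᵗ (chain-suffix cu t-chain))

  maxSafe⇒sleaf : Chain (SParent G) s b (pre ++ u) → Chain (flip (TParent G)) a t (u ++ rest) →
                  MaxSafe G ((pre ++ u) ++ rest) → SLeaf G u
  maxSafe⇒sleaf {pre} s-chain t-chain maxSafe D (_ , mD , u≢D , _ , y , x∈ , y∈ , b→y)
    with _ , _ , d , _ ← maxUnivocal⇒chain mD
    with refl , refl ← csparent-ends mu mD u≢D cu d x∈ y∈ b→y
    with e , rest′ , refl , b→e , e-chain ← chain-step (λ b≡t → ¬sparent-sink (subst (λ z → SParent G z y) b≡t b→y))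
                                                       (chain-suffix cu t-chain)
    = proj₂ (maxUnivocal⇒unextendable mu cu) e (b→e , t-children , subst (SParent G b) y≡e b→y , s-children)
    where
    insert : ∀ {c} → b ⊏ c → e ⊏ᵗ c → ⊥
    insert = no-insertion (pre ++ u) (e ∷ rest′) maxSafe refl (chain-map sparent⇒⊏ s-chain) (chain-map tparent⇒⊏ᵗ e-chain)
    s-children : ∀ c → SParent G b c → c ≡ e
    s-children c b→c with c ≟ e
    ... | yes c≡e = c≡e
    ... | no c≢e  = ⊥-elim (insert (sparent⇒⊏ b→c) (tparent-tdom-schild b→e b→c , c≢e ∘ sym))
    y≡e : y ≡ e
    y≡e = s-children y b→y
    t-children : ∀ c → TParent G e c → c ≡ b
    t-children c e→c with c ≟ b
    ... | yes c≡b = c≡b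
    ... | no c≢b  = ⊥-elim (insert (sparent-sdom-tchild (subst (SParent G b) y≡e b→y) e→c , c≢b ∘ sym) (tparent⇒⊏ᵗ e→c))

  maxSafe⇒tleaf : Chain (SParent G) s b (pre ++ u) → Chain (flip (TParent G)) a t (u ++ rest) →
                  MaxSafe G ((pre ++ u) ++ rest) → TLeaf G u
  maxSafe⇒tleaf {pre} {rest} s-chain t-chain maxSafe D (_ , mD , u≢D , _ , y , x∈ , y∈ , a→y)
    with _ , _ , d , _ ← maxUnivocal⇒chain mD
    with refl , refl ← ctparent-ends mu mD u≢D cu d x∈ y∈ a→y
    with initLast pre | chain-prefix cu s-chain
  ... | []          | s-to-a =
    ¬tparent-source (subst (λ z → TParent G z y) (sym (same-first s-to-a (here {R = SParent G} a))) a→y)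
  ... | pre′ ∷ʳ′ f | s-to-a =
    proj₁ (maxUnivocal⇒unextendable mu cu) f (subst (TParent G a) y≡f a→y , t-children , f→a , s-children)
    where
    s-to-a′ : Chain (SParent G) s a (pre′ ++ f ∷ a ∷ [])
    s-to-a′ = subst (Chain (SParent G) s a) (++-assoc pre′ (f ∷ []) (a ∷ [])) s-to-a
    f→a : SParent G f a
    f→a = proj₁ (chain-tail (chain-drop pre′ s-to-a′))
    insert : ∀ {c} → f ⊏ c → a ⊏ᵗ c → ⊥
    insert = no-insertion (pre′ ++ f ∷ []) (u ++ rest) maxSafe (++-assoc (pre′ ++ f ∷ []) u rest)
                          (chain-map sparent⇒⊏ (chain-take pre′ s-to-a′)) (chain-map tparent⇒⊏ᵗ t-chain)
    t-children : ∀ c → TParent G a c → c ≡ f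
    t-children c a→c with c ≟ f
    ... | yes c≡f = c≡f
    ... | no c≢f  = ⊥-elim (insert (sparent-sdom-tchild f→a a→c , c≢f ∘ sym) (tparent⇒⊏ᵗ a→c))
    y≡f : y ≡ f
    y≡f = t-children y a→y
    s-children : ∀ c → SParent G f c → c ≡ a
    s-children c f→c with c ≟ a
    ... | yes c≡a = c≡a
    ... | no c≢a  = ⊥-elim (insert (sparent⇒⊏ f→c) (tparent-tdom-schild (subst (TParent G a) y≡f a→y) f→c , c≢a ∘ sym))

  module _ (s-leaf : SLeaf G u) (t-leaf : TLeaf G u) where

    no-s-exit : ∀ {x z L} → Chain (SParent G) x z L → x ∈ u → z ∉ u → ⊥
    no-s-exit c x∈u z∉u with v , w , v→w , v∈ , w∉u ← chain-crossing (λ v → ¬? (v ∈? u)) c (λ x∉u → x∉u x∈u) z∉u =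
      s-leaf (class w) (mu , class-max w , (λ u≡ → w∉u (subst (w ∈_) (sym u≡) (∈-class w))) ,
                        v , w , decidable-stable (v ∈? u) v∈ , ∈-class w , v→w)

    no-t-entry : ∀ {z y L} → Chain (flip (TParent G)) z y L → z ∉ u → y ∈ u → ⊥
    no-t-entry c z∉u y∈u with v , w , w→v , v∉u , w∈u ← chain-crossing (_∈? u) c z∉u y∈u =
      t-leaf (class v) (mu , class-max v , (λ u≡ → v∉u (subst (v ∈_) (sym u≡) (∈-class v))) ,
                        w , v , w∈u , ∈-class v , w→v)

    tree-route : ∀ {z} → z ∉ u → ∃[ E ] (Chain (Bypassable _≟_ {E = Edge}) s t E × z ∈ E × a ∉ E)
    tree-route {z} z∉u with L₁ , down ← s-tree-path z with L₂ , up ← t-tree-path z with L₂′ , refl ← chain-uncons up =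
      L₁ ++ L₂′ , chain-++ (chain-map sparent-bypassable down) (chain-map tparent-bypassable up) ,
      ∈-++⁺ˡ (last∈ down) , avoids-a
      where
      avoids-a : a ∉ L₁ ++ L₂′
      avoids-a a∈ with ∈-++⁻ L₁ a∈
      ... | inj₁ a∈L₁ with _ , _ , _ , _ , a-to-z ← chain-split down a∈L₁ = no-s-exit a-to-z (first∈ cu) z∉u
      ... | inj₂ a∈L₂′ with _ , _ , _ , z-to-a , _ ← chain-split up (there a∈L₂′) = no-t-entry z-to-a z∉u (first∈ cu)

    avoiding-cover : Chain (SParent G) s b (pre ++ u) → Chain (flip (TParent G)) a t (u ++ rest) →
                     ∀ {Y} → (pre ++ u) ++ rest ⊆ Y → ¬ Y ⊆ (pre ++ u) ++ rest →
                     IsWalkCover G (λ w → Walk s t w × ¬ Y ⊆ w)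
    avoiding-cover {pre} {rest} s-chain t-chain {Y} X⊆Y Y⊈X = (λ _ → proj₁) , cover
      where
      a∈X : a ∈ (pre ++ u) ++ rest
      a∈X = ∈-++⁺ˡ (∈-++⁺ʳ pre (first∈ cu))
      ext-route : Chain (Bypassable _≟_ {E = Edge}) s t ((pre ++ u) ++ rest)
      ext-route = chain-++ (chain-map sparent-bypassable s-chain) (chain-map tparent-bypassable (chain-suffix cu t-chain))
      cover : ∀ z → ∃[ w ] ((Walk s t w × ¬ Y ⊆ w) × z ∈ w)
      cover z with z ∈? u
      ... | yes z∈u with w , walk , Y⊈w , X⊆w ← avoiding-walk _≟_ ext-route Y⊈X =
        w , (walk , Y⊈w) , X⊆w (∈-++⁺ˡ (∈-++⁺ʳ pre z∈u))
      ... | no z∉u with E , route , z∈E , a∉E ← tree-route z∉u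
        with w , walk , Y⊈w , E⊆w ← avoiding-walk _≟_ route (λ Y⊆E → a∉E (lookup Y⊆E (lookup X⊆Y a∈X))) =
        w , (walk , Y⊈w) , E⊆w z∈E

    leaves⇒maximal : Chain (SParent G) s b (pre ++ u) → Chain (flip (TParent G)) a t (u ++ rest) →
                     ∀ Y → Safe G Y → (pre ++ u) ++ rest ⊆ Y → (pre ++ u) ++ rest ≡ Y
    leaves⇒maximal {pre} {rest} s-chain t-chain Y (_ , Y-safe) X⊆Y with Y ⊆? (pre ++ u) ++ rest
    ... | yes Y⊆X = ⊆-antisym X⊆Y Y⊆X
    ... | no Y⊈X with _ , (_ , Y⊈w) , Y⊆w ← Y-safe _ (avoiding-cover s-chain t-chain X⊆Y Y⊈X) = ⊥-elim (Y⊈w Y⊆w)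

theorem3p5 : (G : STGraph) → (u : List (Fin (STGraph.n G))) → MaxUnivocal G u →
    (∃[ X ] IsExt G u X) ×
    (∀ X → IsExt G u X → (MaxSafe G X ⇔ (SLeaf G u × TLeaf G u)))
theorem3p5 G u mu = ext-exists mu , characterisation
  where
  open Univocality G
  characterisation : ∀ X → IsExt G u X → MaxSafe G X ⇔ (SLeaf G u × TLeaf G u)
  characterisation X ext with _ , _ , cu , _ ← maxUnivocal⇒chain mu with _ , _ , refl , s-chain , t-chain ← ext-decomposition cu ext =
    mk⇔ (λ maxSafe → maxSafe⇒sleaf s-chain t-chain maxSafe , maxSafe⇒tleaf s-chain t-chain maxSafe)
        (λ (s-leaf , t-leaf) → ext-safe s-chain t-chain , leaves⇒maximal s-leaf t-leaf s-chain t-chain)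
    where open ExtMaximality G mu cu
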